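{- A linear code $C\subseteq\mathbb{F}_3^n$ is trifferent if and only if it is minimal.
   Context: A linear code $C\subseteq\mathbb{F}_3^n$ is a linear subspace. It is trifferent if for any three distinct $x,y,z\in C$ there exists a coordinate $i$ with $\{x_i,y_i,z_i\}=\mathbb{F}_3$. The support of $v\in\mathbb{F}_3^n$ is $\operatorname{supp}(v)=\{i: v_i\neq 0\}$. A nonzero codeword $v\in C$ is minimal if $\operatorname{supp}(v)$ is minimal with respect to inclusion among the supports of nonzero codewords of $C$; $C$ is a minimal code if all its nonzero codewords are minimal. -}

module Defs where

open import Level using (0ℓ)
open import Data.Nat using (ℕ)
open import Data.Fin using (Fin; zero; suc)
open import Data.Vec using (Vec; lookup; replicate; zipWith; map)
open import Data.Product using (Σ; ∃; _×_; _,_)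
open import Data.Sum using (_⊎_)
open import Relation.Binary.PropositionalEquality using (_≡_; _≢_)

F3 : Set
F3 = Fin 3

0F : F3
0F = zero

_+₃_ : F3 → F3 → F3
zero +₃ b = b
suc zero +₃ zero = suc zero
suc zero +₃ suc zero = suc (suc zero)
suc zero +₃ suc (suc zero) = zero
suc (suc zero) +₃ zero = suc (suc zero)
suc (suc zero) +₃ suc zero = zero
suc (suc zero) +₃ suc (suc zero) = suc zero

_*₃_ : F3 → F3 → F3
zero *₃ b = zero
suc zero *₃ b = b
suc (suc zero) *₃ zero = zero
suc (suc zero) *₃ suc zero = suc (suc zero)
suc (suc zero) *₃ suc (suc zero) = suc zero

Word : ℕ → Set
Word n = Vec F3 n

0W : ∀ {n} → Word n
0W = replicate _ 0F

_⊕_ : ∀ {n} → Word n → Word n → Word n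
_⊕_ = zipWith _+₃_

_·_ : ∀ {n} → F3 → Word n → Word n
a · v = map (a *₃_) v

record LinearCode (n : ℕ) : Set₁ where
  field
    _∈C : Word n → Set
    zero∈ : 0W ∈C
    add∈ : ∀ {x y} → x ∈C → y ∈C → (x ⊕ y) ∈C
    smul∈ : ∀ (a : F3) {x} → x ∈C → (a · x) ∈C
open LinearCode public

Trifferent : ∀ {n} → LinearCode n → Set
Trifferent {n} C =
  ∀ (x y z : Word n) → _∈C C x → _∈C C y → _∈C C z →
  x ≢ y → y ≢ z → x ≢ z →
  Σ (Fin n) λ i → ∀ (a : F3) →
    a ≡ lookup x i ⊎ a ≡ lookup y i ⊎ a ≡ lookup z i

_∈supp_ : ∀ {n} → Fin n → Word n → Set
i ∈supp v = lookup v i ≢ 0F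

_⊆supp_ : ∀ {n} → Word n → Word n → Set
v ⊆supp w = ∀ i → i ∈supp v → i ∈supp w

MinimalCodeword : ∀ {n} → LinearCode n → Word n → Set
MinimalCodeword {n} C v =
  _∈C C v × v ≢ 0W ×
  (∀ (w : Word n) → _∈C C w → w ≢ 0W → w ⊆supp v → v ⊆supp w)

MinimalCode : ∀ {n} → LinearCode n → Set
MinimalCode {n} C = ∀ (v : Word n) → _∈C C v → v ≢ 0W → MinimalCodeword C v

{-# OPTIONS --safe #-}
module Submission where

-- Trifferent ⇒ minimal: if w is a nonzero codeword with supp w ⊊ supp v, the
-- codewords 0, v + w, v − w are distinct, and a coordinate j separating them
-- needs v_j + w_j and v_j − w_j to be the two distinct nonzero elements of F₃;
-- their sum 2v_j is then 0, so v_j = 0 while w_j ≠ 0, contradicting supp w ⊆ supp v.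
--
-- Minimal ⇒ trifferent: translating by −x, it suffices to separate 0, a = y − x,
-- b = z − x. If no coordinate does, then at every i one of a_i, b_i is zero or
-- a_i = b_i; hence supp a and supp b lie in supp (a + b), and minimality of
-- a + b forces all three supports to coincide, which with the same trichotomy
-- gives a = b, i.e. y = z.

open import Defs
open import Data.Nat using (ℕ)
open import Data.Product using (_×_; _,_; proj₂)
open import Data.Fin using (zero; suc; _≟_)
open import Data.Fin.Properties using (any?; all?)
open import Data.Sum using (_⊎_; inj₁; inj₂; map₂; swap)
open import Data.Empty using (⊥-elim)
open import Data.Vec using (lookup)
open import Data.Vec.Properties using (lookup-zipWith; lookup-map; lookup-replicate)
open import Data.Vec.Relation.Binary.Pointwise.Extensional using (ext; Pointwise-≡⇒≡)
open import Function using (_∘_)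
open import Relation.Nullary using (¬_; Dec; yes; no; contradiction)
open import Relation.Nullary.Decidable using (_⊎-dec_; decidable-stable)
open import Relation.Binary.PropositionalEquality
  using (_≡_; _≢_; refl; sym; trans; cong; subst)

pattern 1F = suc zero
pattern 2F = suc (suc zero)

-- Subtraction, since 2 = −1 in F₃.
_-₃_ : F3 → F3 → F3
p -₃ q = p +₃ (2F *₃ q)

_⊖_ : ∀ {n} → Word n → Word n → Word n
v ⊖ w = v ⊕ (2F · w)

Separates : F3 → F3 → F3 → Set
Separates p q r = ∀ c → c ≡ p ⊎ c ≡ q ⊎ c ≡ r

+₃-identityʳ : ∀ p → p +₃ 0F ≡ p
+₃-identityʳ zero = refl
+₃-identityʳ 1F = refl
+₃-identityʳ 2F = refl

-₃-identityʳ : ∀ p → p -₃ 0F ≡ p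
-₃-identityʳ zero = refl
-₃-identityʳ 1F = refl
-₃-identityʳ 2F = refl

-₃-inverse : ∀ p → p -₃ p ≡ 0F
-₃-inverse zero = refl
-₃-inverse 1F = refl
-₃-inverse 2F = refl

-₃-+₃-cancel : ∀ p q → (p -₃ q) +₃ q ≡ p
-₃-+₃-cancel zero zero = refl
-₃-+₃-cancel zero 1F = refl
-₃-+₃-cancel zero 2F = refl
-₃-+₃-cancel 1F zero = refl
-₃-+₃-cancel 1F 1F = refl
-₃-+₃-cancel 1F 2F = refl
-₃-+₃-cancel 2F zero = refl
-₃-+₃-cancel 2F 1F = refl
-₃-+₃-cancel 2F 2F = refl

-₃-cancelʳ : ∀ {p q} r → p -₃ r ≡ q -₃ r → p ≡ q
-₃-cancelʳ {p} {q} r e =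
  trans (sym (-₃-+₃-cancel p r)) (trans (cong (_+₃ r) e) (-₃-+₃-cancel q r))

-₃≡0⇒≡ : ∀ {p q} → p -₃ q ≡ 0F → p ≡ q
-₃≡0⇒≡ {q = q} e = -₃-cancelʳ q (trans e (sym (-₃-inverse q)))

+₃-self-nonzero : ∀ {p} → p ≢ 0F → p +₃ p ≢ 0F
+₃-self-nonzero {zero} p≢0 = contradiction refl p≢0
+₃-self-nonzero {1F} _ = λ ()
+₃-self-nonzero {2F} _ = λ ()

+₃≡-₃⇒≡0 : ∀ p q → p +₃ q ≡ p -₃ q → q ≡ 0F
+₃≡-₃⇒≡0 _ zero _ = refl
+₃≡-₃⇒≡0 zero 1F ()
+₃≡-₃⇒≡0 zero 2F ()
+₃≡-₃⇒≡0 1F 1F ()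
+₃≡-₃⇒≡0 1F 2F ()
+₃≡-₃⇒≡0 2F 1F ()
+₃≡-₃⇒≡0 2F 2F ()

separates? : ∀ p q r → Dec (Separates p q r)
separates? p q r = all? λ c → c ≟ p ⊎-dec c ≟ q ⊎-dec c ≟ r

separates-resp : ∀ {p p′ q q′ r r′} → p ≡ p′ → q ≡ q′ → r ≡ r′ →
                 Separates p q r → Separates p′ q′ r′
separates-resp refl refl refl sep = sep

missing⇒¬separates : ∀ {p q r} c → c ≢ p → c ≢ q → c ≢ r → ¬ Separates p q r
missing⇒¬separates c c≢p c≢q c≢r sep with sep c
... | inj₁ c≡p = c≢p c≡p
... | inj₂ (inj₁ c≡q) = c≢q c≡q
... | inj₂ (inj₂ c≡r) = c≢r c≡r

separates-translate : ∀ {p q r} → Separates 0F (q -₃ p) (r -₃ p) → Separates p q r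
separates-translate {p} {q} {r} sep c with sep (c -₃ p)
... | inj₁ e = inj₁ (-₃≡0⇒≡ e)
... | inj₂ (inj₁ e) = inj₂ (inj₁ (-₃-cancelʳ p e))
... | inj₂ (inj₂ e) = inj₂ (inj₂ (-₃-cancelʳ p e))

separates-sum-difference : ∀ p q → Separates 0F (p +₃ q) (p -₃ q) → q ≢ 0F × p ≡ 0F
separates-sum-difference zero zero = ⊥-elim ∘ missing⇒¬separates 1F (λ ()) (λ ()) (λ ())
separates-sum-difference zero 1F _ = (λ ()) , refl
separates-sum-difference zero 2F _ = (λ ()) , refl
separates-sum-difference 1F zero = ⊥-elim ∘ missing⇒¬separates 2F (λ ()) (λ ()) (λ ())
separates-sum-difference 1F 1F = ⊥-elim ∘ missing⇒¬separates 1F (λ ()) (λ ()) (λ ())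
separates-sum-difference 1F 2F = ⊥-elim ∘ missing⇒¬separates 1F (λ ()) (λ ()) (λ ())
separates-sum-difference 2F zero = ⊥-elim ∘ missing⇒¬separates 1F (λ ()) (λ ()) (λ ())
separates-sum-difference 2F 1F = ⊥-elim ∘ missing⇒¬separates 2F (λ ()) (λ ()) (λ ())
separates-sum-difference 2F 2F = ⊥-elim ∘ missing⇒¬separates 2F (λ ()) (λ ()) (λ ())

separates-0-1-2 : Separates 0F 1F 2F
separates-0-1-2 zero = inj₁ refl
separates-0-1-2 1F = inj₂ (inj₁ refl)
separates-0-1-2 2F = inj₂ (inj₂ refl)

¬separates⇒degenerate : ∀ s t → ¬ Separates 0F s t → s ≡ 0F ⊎ t ≡ 0F ⊎ s ≡ t
¬separates⇒degenerate zero _ _ = inj₁ refl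
¬separates⇒degenerate 1F zero _ = inj₂ (inj₁ refl)
¬separates⇒degenerate 2F zero _ = inj₂ (inj₁ refl)
¬separates⇒degenerate 1F 1F _ = inj₂ (inj₂ refl)
¬separates⇒degenerate 2F 2F _ = inj₂ (inj₂ refl)
¬separates⇒degenerate 1F 2F ¬sep = contradiction separates-0-1-2 ¬sep
¬separates⇒degenerate 2F 1F ¬sep =
  contradiction (map₂ swap ∘ separates-0-1-2) ¬sep

module _ {n : ℕ} where

  ≗⇒≡ : {u v : Word n} → (∀ i → lookup u i ≡ lookup v i) → u ≡ v
  ≗⇒≡ = Pointwise-≡⇒≡ ∘ ext

  ≡⇒lookup≡ : {u v : Word n} → u ≡ v → ∀ i → lookup u i ≡ lookup v i
  ≡⇒lookup≡ e i = cong (λ u → lookup u i) e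

  lookup-0W : ∀ i → lookup (0W {n}) i ≡ 0F
  lookup-0W i = lookup-replicate i 0F

  lookup-⊕ : ∀ (v w : Word n) i → lookup (v ⊕ w) i ≡ lookup v i +₃ lookup w i
  lookup-⊕ v w i = lookup-zipWith _+₃_ i v w

  lookup-⊖ : ∀ (v w : Word n) i → lookup (v ⊖ w) i ≡ lookup v i -₃ lookup w i
  lookup-⊖ v w i =
    trans (lookup-⊕ v (2F · w) i) (cong (lookup v i +₃_) (lookup-map i (2F *₃_) w))

  ∈supp⇒≢0W : ∀ {v : Word n} i → i ∈supp v → v ≢ 0W
  ∈supp⇒≢0W i i∈v v≡0 = i∈v (trans (≡⇒lookup≡ v≡0 i) (lookup-0W i))

  ⊖-cancelʳ : ∀ {u v w : Word n} → u ⊖ w ≡ v ⊖ w → u ≡ v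
  ⊖-cancelʳ {u} {v} {w} e = ≗⇒≡ λ i → -₃-cancelʳ (lookup w i)
    (trans (sym (lookup-⊖ u w i)) (trans (≡⇒lookup≡ e i) (lookup-⊖ v w i)))

  ⊖≡0W⇒≡ : ∀ {u v : Word n} → u ⊖ v ≡ 0W → u ≡ v
  ⊖≡0W⇒≡ {u} {v} e = ≗⇒≡ λ i → -₃≡0⇒≡
    (trans (sym (lookup-⊖ u v i)) (trans (≡⇒lookup≡ e i) (lookup-0W i)))

  ⊕≡⊖⇒≡0W : ∀ {v w : Word n} → v ⊕ w ≡ v ⊖ w → w ≡ 0W
  ⊕≡⊖⇒≡0W {v} {w} e = ≗⇒≡ λ i → trans
    (+₃≡-₃⇒≡0 (lookup v i) (lookup w i)
      (trans (sym (lookup-⊕ v w i)) (trans (≡⇒lookup≡ e i) (lookup-⊖ v w i))))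
    (sym (lookup-0W i))

  ⊆supp⇒≡0F : ∀ (w v : Word n) → w ⊆supp v →
              ∀ {i} → lookup v i ≡ 0F → lookup w i ≡ 0F
  ⊆supp⇒≡0F w v w⊆v {i} v[i]≡0 =
    decidable-stable (lookup w i ≟ 0F) (λ i∈w → w⊆v i i∈w v[i]≡0)

  ⊆supp-0W⇒≡0W : ∀ {w : Word n} → w ⊆supp 0W → w ≡ 0W
  ⊆supp-0W⇒≡0W {w} w⊆0 = ≗⇒≡ λ i →
    trans (⊆supp⇒≡0F w 0W w⊆0 (lookup-0W i)) (sym (lookup-0W i))

  ∈supp-⊕-zeroʳ : ∀ (v w : Word n) {i} →
                  i ∈supp v → lookup w i ≡ 0F → i ∈supp (v ⊕ w)
  ∈supp-⊕-zeroʳ v w {i} i∈v w[i]≡0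
    rewrite lookup-⊕ v w i | w[i]≡0 | +₃-identityʳ (lookup v i) = i∈v

  ∈supp-⊖-zeroʳ : ∀ (v w : Word n) {i} →
                  i ∈supp v → lookup w i ≡ 0F → i ∈supp (v ⊖ w)
  ∈supp-⊖-zeroʳ v w {i} i∈v w[i]≡0
    rewrite lookup-⊖ v w i | w[i]≡0 | -₃-identityʳ (lookup v i) = i∈v

module _ {n : ℕ} (C : LinearCode n) where

  ⊖-closed : ∀ {v w} → _∈C C v → _∈C C w → _∈C C (v ⊖ w)
  ⊖-closed v∈C w∈C = add∈ C v∈C (smul∈ C 2F w∈C)

  trifferent⇒minimal : Trifferent C → MinimalCode C
  trifferent⇒minimal tri v v∈C v≢0 = v∈C , v≢0 , minimal
    where
    minimal : ∀ w → _∈C C w → w ≢ 0W → w ⊆supp v → v ⊆supp w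
    minimal w w∈C w≢0 w⊆v i i∈v w[i]≡0 with
      tri 0W (v ⊕ w) (v ⊖ w) (zero∈ C) (add∈ C v∈C w∈C) (⊖-closed v∈C w∈C)
        (∈supp⇒≢0W i (∈supp-⊕-zeroʳ v w i∈v w[i]≡0) ∘ sym)
        (w≢0 ∘ ⊕≡⊖⇒≡0W)
        (∈supp⇒≢0W i (∈supp-⊖-zeroʳ v w i∈v w[i]≡0) ∘ sym)
    ... | j , sep with separates-sum-difference (lookup v j) (lookup w j)
                         (separates-resp (lookup-0W j) (lookup-⊕ v w j) (lookup-⊖ v w j) sep)
    ...   | j∈w , v[j]≡0 = w⊆v j j∈w v[j]≡0

  unseparated-codewords-equal : MinimalCode C → ∀ {a b} → _∈C C a → _∈C C b →
    a ≢ 0W → b ≢ 0W → (∀ i → ¬ Separates 0F (lookup a i) (lookup b i)) → a ≡ b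
  unseparated-codewords-equal minimal {a} {b} a∈C b∈C a≢0 b≢0 unseparated = ≗⇒≡ agree
    where
    degenerate : ∀ i → lookup a i ≡ 0F ⊎ lookup b i ≡ 0F ⊎ lookup a i ≡ lookup b i
    degenerate i = ¬separates⇒degenerate (lookup a i) (lookup b i) (unseparated i)

    a⊆a⊕b : a ⊆supp (a ⊕ b)
    a⊆a⊕b i i∈a rewrite lookup-⊕ a b i with degenerate i
    ... | inj₁ a[i]≡0 = contradiction a[i]≡0 i∈a
    ... | inj₂ (inj₁ b[i]≡0) rewrite b[i]≡0 | +₃-identityʳ (lookup a i) = i∈a
    ... | inj₂ (inj₂ a[i]≡b[i]) rewrite sym a[i]≡b[i] = +₃-self-nonzero i∈a

    b⊆a⊕b : b ⊆supp (a ⊕ b)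
    b⊆a⊕b i i∈b rewrite lookup-⊕ a b i with degenerate i
    ... | inj₁ a[i]≡0 rewrite a[i]≡0 = i∈b
    ... | inj₂ (inj₁ b[i]≡0) = contradiction b[i]≡0 i∈b
    ... | inj₂ (inj₂ a[i]≡b[i]) rewrite a[i]≡b[i] = +₃-self-nonzero i∈b

    a⊕b≢0 : a ⊕ b ≢ 0W
    a⊕b≢0 a⊕b≡0 = a≢0 (⊆supp-0W⇒≡0W (subst (a ⊆supp_) a⊕b≡0 a⊆a⊕b))

    a⊕b⊆ : ∀ {w} → _∈C C w → w ≢ 0W → w ⊆supp (a ⊕ b) → (a ⊕ b) ⊆supp w
    a⊕b⊆ = proj₂ (proj₂ (minimal (a ⊕ b) (add∈ C a∈C b∈C) a⊕b≢0)) _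

    a⊆b : a ⊆supp b
    a⊆b i = a⊕b⊆ b∈C b≢0 b⊆a⊕b i ∘ a⊆a⊕b i

    b⊆a : b ⊆supp a
    b⊆a i = a⊕b⊆ a∈C a≢0 a⊆a⊕b i ∘ b⊆a⊕b i

    agree : ∀ i → lookup a i ≡ lookup b i
    agree i with degenerate i
    ... | inj₁ a[i]≡0 = trans a[i]≡0 (sym (⊆supp⇒≡0F b a b⊆a a[i]≡0))
    ... | inj₂ (inj₁ b[i]≡0) = trans (⊆supp⇒≡0F a b a⊆b b[i]≡0) (sym b[i]≡0)
    ... | inj₂ (inj₂ a[i]≡b[i]) = a[i]≡b[i]

  minimal⇒trifferent : MinimalCode C → Trifferent C
  minimal⇒trifferent minimal x y z x∈C y∈C z∈C x≢y y≢z x≢z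
    with any? (λ i → separates? (lookup x i) (lookup y i) (lookup z i))
  ... | yes separating = separating
  ... | no ¬separating = contradiction (⊖-cancelʳ y⊖x≡z⊖x) y≢z
    where
    y⊖x≡z⊖x : y ⊖ x ≡ z ⊖ x
    y⊖x≡z⊖x = unseparated-codewords-equal minimal
      (⊖-closed y∈C x∈C) (⊖-closed z∈C x∈C)
      (x≢y ∘ sym ∘ ⊖≡0W⇒≡) (x≢z ∘ sym ∘ ⊖≡0W⇒≡)
      (λ i sep → ¬separating (i , separates-translate
        (separates-resp refl (lookup-⊖ y x i) (lookup-⊖ z x i) sep)))

theorem6p2 : ∀ (n : ℕ) (C : LinearCode n) →
    (Trifferent C → MinimalCode C) × (MinimalCode C → Trifferent C)
theorem6p2 n C = trifferent⇒minimal C , minimal⇒trifferent C
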